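{- Let $X$ be a non-empty set of positive integers with $X\neq\{1\}$, and suppose $B(X)$ contains a cycle of length greater than $4$. Then each of $\Delta(X)$ and $\Gamma(X)$ contains a cycle. Moreover, for $\Phi\in\{\Delta(X),\Gamma(X)\}$, either $\mathbf{g}(\Phi)=3$ or $\mathbf{g}(\Phi)=\frac12\mathbf{g}'(B(X))$, where $\mathbf{g}'(B(X))$ is the minimum length of cycles of $B(X)$ with more than four vertices.
   Context: For a non-empty set $X$ of positive integers, $\rho(X)$ is the set of primes dividing some element of $X$ and $X^*=X\setminus\{1\}$. $B(X)$ is the bipartite graph with vertex set the disjoint union $\rho(X)\cup X^*$ and edges $\{p,x\}$ for $p\in\rho(X)$, $x\in X^*$, $p\mid x$. $\Delta(X)$ has vertex set $\rho(X)$, distinct $p,q$ adjacent iff $pq$ divides some element of $X$. $\Gamma(X)$ has vertex set $X^*$, distinct $x,y$ adjacent iff $\gcd(x,y)>1$. A cycle is a closed path of length at least $3$; the girth $\mathbf{g}(\Phi)$ of a graph containing a cycle is the minimum length of its cycles. -}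

module Defs where

open import Data.Nat using (ℕ; zero; suc; _+_; _*_; _≤_; _<_)
open import Data.Nat.Divisibility using (_∣_)
open import Data.Nat.GCD using (gcd)
open import Data.Nat.Primality using (Prime)
open import Data.Fin using (Fin; toℕ)
open import Data.Product using (Σ; ∃; _×_)
open import Data.Sum using (_⊎_; inj₁; inj₂)
open import Data.Empty using (⊥)
open import Relation.Binary.PropositionalEquality using (_≡_; _≢_)
open import Function.Definitions using (Injective)

Subset : Set₁
Subset = ℕ → Set

record Graph : Set₁ where
  field
    V   : Set
    Vtx : V → Set
    Adj : V → V → Set
open Graph public

ρ : Subset → ℕ → Set
ρ X p = Prime p × ∃ λ x → X x × p ∣ x

Star : Subset → ℕ → Set
Star X x = X x × x ≢ 1

BAdj : ℕ ⊎ ℕ → ℕ ⊎ ℕ → Set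
BAdj (inj₁ p) (inj₂ x) = p ∣ x
BAdj (inj₂ x) (inj₁ p) = p ∣ x
BAdj (inj₁ _) (inj₁ _) = ⊥
BAdj (inj₂ _) (inj₂ _) = ⊥

BVtx : Subset → ℕ ⊎ ℕ → Set
BVtx X (inj₁ p) = ρ X p
BVtx X (inj₂ x) = Star X x

B : Subset → Graph
B X = record { V = ℕ ⊎ ℕ ; Vtx = BVtx X ; Adj = BAdj }

Δ : Subset → Graph
Δ X = record { V = ℕ ; Vtx = ρ X ; Adj = λ p q → p ≢ q × ∃ λ x → X x × (p * q) ∣ x }

Γ : Subset → Graph
Γ X = record { V = ℕ ; Vtx = Star X ; Adj = λ x y → x ≢ y × 1 < gcd x y }

HasCycle : Graph → ℕ → Set
HasCycle G n =
  3 ≤ n ×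
  Σ (Fin n → V G) λ c →
    (∀ i → Vtx G (c i)) ×
    Injective _≡_ _≡_ c ×
    (∀ i j → toℕ j ≡ suc (toℕ i) → Adj G (c i) (c j)) ×
    (∀ i j → suc (toℕ i) ≡ n → toℕ j ≡ 0 → Adj G (c i) (c j))

IsGirth : Graph → ℕ → Set
IsGirth G g = HasCycle G g × (∀ n → HasCycle G n → g ≤ n)

IsGirth' : Graph → ℕ → Set
IsGirth' G g = (4 < g × HasCycle G g) × (∀ n → 4 < n → HasCycle G n → g ≤ n)

-- Walking around a cycle of B(X) alternates between primes and elements of X*, so
-- the cycle has even length 2k, and every second vertex of it gives a k-cycle in
-- Δ(X) (consecutive primes divide the element between them) or in Γ(X) (consecutive
-- elements share the prime between them): Δ(X) and Γ(X) are the two halved graphs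
-- of the bipartite graph B(X). Conversely a g-cycle of a halved graph lifts to a
-- 2g-cycle of B(X) by inserting a common neighbour between consecutive vertices.
-- The inserted vertices are distinct unless one of them is a common neighbour of
-- three distinct cycle vertices, which then form a triangle. So if the girth g of a
-- halved graph is not 3, then g ≤ g'/2 ≤ g.

module Submission where

open import Defs
open import Data.Bool using (Bool; true; false; not)
import Data.Bool as Bool
open import Data.Bool.Properties using (not-¬; ¬-not; not-involutive)
open import Data.Empty using (⊥-elim)
open import Data.Fin using (Fin; toℕ; fromℕ<)
import Data.Fin
open import Data.Fin.Properties using (toℕ-injective; toℕ-fromℕ<; toℕ<n; fromℕ<-cong)
open import Data.List using ([]; _∷_)
open import Data.List.Relation.Unary.All using (_∷_)
open import Data.Nat
open import Data.Nat.Properties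
open import Data.Nat.DivMod
open import Data.Nat.Divisibility using (_∣_; divides; ∣-trans; m∣m*n; n∣m*n; ∣⇒≤; ∣1⇒≡1)
open import Data.Nat.GCD using (gcd; gcd[m,n]∣m; gcd[m,n]∣n; gcd-greatest; gcd[m,n]≡0⇒m≡0)
open import Data.Nat.Primality using (Prime; prime⇒irreducible; prime⇒nonTrivial; ¬prime[1])
open import Data.Nat.Primality.Factorisation using (factorise)
open import Data.Nat.Coprimality using (Coprime; coprime-divisor)
open import Data.Product using (∃; _×_; _,_; proj₁; proj₂; map₂)
open import Data.Sum using (_⊎_; inj₁; inj₂; [_,_]′; reduce)
open import Data.Sum.Properties using (inj₁-injective; inj₂-injective)
open import Function using (_∘_; const)
open import Relation.Binary.Definitions using (Symmetric; tri<; tri≈; tri>)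
open import Relation.Binary.PropositionalEquality
open import Relation.Nullary using (¬_; yes; no)

data ParityView : ℕ → Set where
  even : ∀ k → ParityView (k * 2)
  odd  : ∀ k → ParityView (suc (k * 2))

parityView : ∀ n → ParityView n
parityView zero = even 0
parityView (suc n) with parityView n
... | even k = odd k
... | odd k  = even (suc k)

parityView-even : ∀ k → parityView (k * 2) ≡ even k
parityView-even zero = refl
parityView-even (suc k) rewrite parityView-even k = refl

parityView-odd : ∀ k → parityView (suc (k * 2)) ≡ odd k
parityView-odd k rewrite parityView-even k = refl

interleave : {A : Set} → (ℕ → A) → (ℕ → A) → ℕ → A
interleave f h n with parityView n
... | even k = f k
... | odd k  = h k

interleave-even : ∀ {A : Set} (f h : ℕ → A) k → interleave f h (k * 2) ≡ f k
interleave-even f h k rewrite parityView-even k = refl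

interleave-odd : ∀ {A : Set} (f h : ℕ → A) k → interleave f h (suc (k * 2)) ≡ h k
interleave-odd f h k rewrite parityView-odd k = refl

4<*2⇒3≤ : ∀ k → 4 < k * 2 → 3 ≤ k
4<*2⇒3≤ k 4<2k = ≮⇒≥ (λ k<3 → <⇒≱ 4<2k (*-monoˡ-≤ 2 (s≤s⁻¹ k<3)))

*2-cancel-<-+ : ∀ i m {j} → j * 2 < i * 2 + m * 2 → j < i + m
*2-cancel-<-+ i m {j} lt = *-cancelʳ-< 2 j (i + m) (subst (j * 2 <_) (sym (*-distribʳ-+ 2 i m)) lt)

%-injective-window : ∀ {i j n} .{{_ : NonZero n}} → i < j → j < i + n → i % n ≢ j % n
%-injective-window {i} {j} {n} i<j j<i+n i%n≡j%n = <⇒≱ j<i+n i+n≤j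
  where
  r = i % n
  i≡ : i ≡ r + i / n * n
  i≡ = m≡m%n+[m/n]*n i n
  j≡ : j ≡ r + j / n * n
  j≡ = trans (m≡m%n+[m/n]*n j n) (cong (_+ j / n * n) (sym i%n≡j%n))
  quotient< : i / n < j / n
  quotient< = *-cancelʳ-< n (i / n) (j / n) (+-cancelˡ-< r _ _ (subst₂ _<_ i≡ j≡ i<j))
  i+n≤j : i + n ≤ j
  i+n≤j = begin
    i + n               ≡⟨ cong (_+ n) i≡ ⟩
    r + i / n * n + n   ≡⟨ +-assoc r _ n ⟩
    r + (i / n * n + n) ≡⟨ cong (r +_) (+-comm (i / n * n) n) ⟩
    r + suc (i / n) * n ≤⟨ +-monoʳ-≤ r (*-monoˡ-≤ n quotient<) ⟩
    r + j / n * n       ≡⟨ j≡ ⟨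
    j                   ∎
    where open ≤-Reasoning

suc-% : ∀ i n .{{_ : NonZero n}} → suc i % n ≡ suc (i % n) % n
suc-% i n = trans (cong (λ m → suc m % n) (m≡m%n+[m/n]*n i n)) ([m+kn]%n≡m%n (suc (i % n)) (i / n) n)

-- Cycles as periodic sequences

-- Indexing by ℕ instead of Fin n lets a cycle be rotated, halved and interleaved
-- without wrap-around cases.
record IsCycle (G : Graph) (n : ℕ) (c : ℕ → V G) : Set where
  field
    3≤n      : 3 ≤ n
    vertex   : ∀ i → Vtx G (c i)
    adjacent : ∀ i → Adj G (c i) (c (suc i))
    periodic : ∀ i → c (n + i) ≡ c i
    distinct : ∀ {i j} → i < j → j < i + n → c i ≢ c j

  instance
    n-nonZero : NonZero n
    n-nonZero = >-nonZero (<-≤-trans z<s 3≤n)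

  closed : c n ≡ c 0
  closed = trans (cong c (sym (+-identityʳ n))) (periodic 0)

  periodic-* : ∀ q i → c (q * n + i) ≡ c i
  periodic-* zero i = refl
  periodic-* (suc q) i = trans (cong c (+-assoc n (q * n) i)) (trans (periodic _) (periodic-* q i))

  periodic-% : ∀ k i → c (k + i % n) ≡ c (k + i)
  periodic-% k i = begin
    c (k + i % n)               ≡⟨ periodic-* (i / n) _ ⟨
    c (i / n * n + (k + i % n)) ≡⟨ cong c (+-comm (i / n * n) _) ⟩
    c (k + i % n + i / n * n)   ≡⟨ cong c (+-assoc k (i % n) _) ⟩
    c (k + (i % n + i / n * n)) ≡⟨ cong (λ m → c (k + m)) (m≡m%n+[m/n]*n i n) ⟨
    c (k + i)                   ∎
    where open ≡-Reasoning

  distinct-+ : ∀ {d} i → 0 < d → d < n → c i ≢ c (d + i)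
  distinct-+ {d} i 0<d d<n = distinct (m<n+m i 0<d) (subst (d + i <_) (+-comm n i) (+-monoˡ-< i d<n))

  injective : ∀ {i j} → i < n → j < n → c i ≡ c j → i ≡ j
  injective {i} {j} i<n j<n ci≡cj with <-cmp i j
  ... | tri< i<j _ _ = ⊥-elim (distinct i<j (<-≤-trans j<n (m≤n+m n i)) ci≡cj)
  ... | tri≈ _ i≡j _ = i≡j
  ... | tri> _ _ j<i = ⊥-elim (distinct j<i (<-≤-trans i<n (m≤n+m n j)) (sym ci≡cj))

  rotate : IsCycle G n (c ∘ suc)
  rotate = record
    { 3≤n      = 3≤n
    ; vertex   = vertex ∘ suc
    ; adjacent = adjacent ∘ suc
    ; periodic = λ i → trans (cong c (sym (+-suc n i))) (periodic (suc i))
    ; distinct = λ i<j j<i+n → distinct (s<s i<j) (s<s j<i+n)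
    }

fromCycle : ∀ {G n c} → IsCycle G n c → HasCycle G n
fromCycle {G} {n} {c} C = 3≤n , c ∘ toℕ , vertex ∘ toℕ , injective′ , step , wrap
  where
  open IsCycle C
  injective′ : ∀ {i j} → c (toℕ i) ≡ c (toℕ j) → i ≡ j
  injective′ {i} {j} = toℕ-injective ∘ injective (toℕ<n i) (toℕ<n j)
  step : ∀ i j → toℕ j ≡ suc (toℕ i) → Adj G (c (toℕ i)) (c (toℕ j))
  step i j j≡1+i = subst (Adj G _ ∘ c) (sym j≡1+i) (adjacent (toℕ i))
  wrap : ∀ i j → suc (toℕ i) ≡ n → toℕ j ≡ 0 → Adj G (c (toℕ i)) (c (toℕ j))
  wrap i j 1+i≡n j≡0 =
    subst (Adj G _) (trans (cong c 1+i≡n) (trans closed (cong c (sym j≡0)))) (adjacent (toℕ i))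

toCycle : ∀ {G n} → HasCycle G n → ∃ (IsCycle G n)
toCycle {n = zero} (() , _)
toCycle {G} {n@(suc _)} (3≤n , h , vertex , injective , step , wrap) = h ∘ index , record
  { 3≤n      = 3≤n
  ; vertex   = vertex ∘ index
  ; adjacent = adjacent
  ; periodic = λ i → cong h (fromℕ<-cong _ _ (trans (cong (_% n) (+-comm n i)) ([m+n]%n≡m%n i n)) _ _)
  ; distinct = λ {i} {j} i<j j<i+n → %-injective-window i<j j<i+n ∘ h-index-injective {i} {j}
  }
  where
  index : ℕ → Fin n
  index i = fromℕ< (m%n<n i n)
  toℕ-index : ∀ i → toℕ (index i) ≡ i % n
  toℕ-index i = toℕ-fromℕ< _
  h-index-injective : ∀ {i j} → h (index i) ≡ h (index j) → i % n ≡ j % n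
  h-index-injective {i} {j} e = trans (sym (toℕ-index i)) (trans (cong toℕ (injective e)) (toℕ-index j))
  adjacent : ∀ i → Adj G (h (index i)) (h (index (suc i)))
  adjacent i with suc (i % n) <? n
  ... | yes 1+r<n = step (index i) (index (suc i)) (begin
    toℕ (index (suc i))  ≡⟨ toℕ-index (suc i) ⟩
    suc i % n            ≡⟨ suc-% i n ⟩
    suc (i % n) % n      ≡⟨ m<n⇒m%n≡m 1+r<n ⟩
    suc (i % n)          ≡⟨ cong suc (toℕ-index i) ⟨
    suc (toℕ (index i))  ∎)
    where open ≡-Reasoning
  ... | no 1+r≮n = wrap (index i) (index (suc i)) (trans (cong suc (toℕ-index i)) 1+r≡n) (begin
    toℕ (index (suc i))  ≡⟨ toℕ-index (suc i) ⟩
    suc i % n            ≡⟨ suc-% i n ⟩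
    suc (i % n) % n      ≡⟨ cong (_% n) 1+r≡n ⟩
    n % n                ≡⟨ n%n≡0 n ⟩
    0                    ∎)
    where
    open ≡-Reasoning
    1+r≡n : suc (i % n) ≡ n
    1+r≡n = ≤-antisym (m%n<n i n) (≮⇒≥ 1+r≮n)

triangle : ∀ G {u v w} → Vtx G u → Vtx G v → Vtx G w → u ≢ v → v ≢ w → w ≢ u →
  Adj G u v → Adj G v w → Adj G w u → HasCycle G 3
triangle G {u} {v} {w} vu vv vw u≢v v≢w w≢u u~v v~w w~u = ≤-refl , t , vertex , injective , step , wrap
  where
  open Data.Fin using (zero; suc)
  t : Fin 3 → V G
  t zero             = u
  t (suc zero)       = v
  t (suc (suc zero)) = w
  vertex : ∀ i → Vtx G (t i)
  vertex zero             = vu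
  vertex (suc zero)       = vv
  vertex (suc (suc zero)) = vw
  injective : ∀ {i j} → t i ≡ t j → i ≡ j
  injective {zero}             {zero}             _ = refl
  injective {zero}             {suc zero}         e = ⊥-elim (u≢v e)
  injective {zero}             {suc (suc zero)}   e = ⊥-elim (w≢u (sym e))
  injective {suc zero}         {zero}             e = ⊥-elim (u≢v (sym e))
  injective {suc zero}         {suc zero}         _ = refl
  injective {suc zero}         {suc (suc zero)}   e = ⊥-elim (v≢w e)
  injective {suc (suc zero)}   {zero}             e = ⊥-elim (w≢u e)
  injective {suc (suc zero)}   {suc zero}         e = ⊥-elim (v≢w (sym e))
  injective {suc (suc zero)}   {suc (suc zero)}   _ = refl
  step : ∀ i j → toℕ j ≡ suc (toℕ i) → Adj G (t i) (t j)
  step zero             (suc zero)       _ = u~v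
  step (suc zero)       (suc (suc zero)) _ = v~w
  wrap : ∀ i j → suc (toℕ i) ≡ 3 → toℕ j ≡ 0 → Adj G (t i) (t j)
  wrap (suc (suc zero)) zero _ _ = w~u

record Embedding (G H : Graph) : Set where
  field
    map       : V G → V H
    vertex    : ∀ {u} → Vtx G u → Vtx H (map u)
    adjacent  : ∀ {u v} → Vtx G u → Vtx G v → Adj G u v → Adj H (map u) (map v)
    injective : ∀ {u v} → Vtx G u → Vtx G v → map u ≡ map v → u ≡ v

  hasCycle : ∀ {n} → HasCycle G n → HasCycle H n
  hasCycle (3≤n , c , vtx , inj , step , wrap) =
    3≤n , map ∘ c , vertex ∘ vtx , (λ {i} {j} → inj ∘ injective (vtx i) (vtx j)) ,
    (λ i j → adjacent (vtx i) (vtx j) ∘ step i j) ,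
    (λ i j e → adjacent (vtx i) (vtx j) ∘ wrap i j e)

isGirth-transfer : ∀ {G H g} → Embedding G H → Embedding H G → IsGirth G g → IsGirth H g
isGirth-transfer G↪H H↪G (cycle , minimal) =
  Embedding.hasCycle G↪H cycle , λ n → minimal n ∘ Embedding.hasCycle H↪G

-- Halved graphs

Halved : (G : Graph) → (V G → Bool) → Bool → Graph
Halved G side s = record
  { V   = V G
  ; Vtx = λ u → Vtx G u × side u ≡ s
  ; Adj = λ u v → u ≢ v × ∃ λ w → Vtx G w × Adj G u w × Adj G w v
  }

IsBipartite : (G : Graph) → (V G → Bool) → Set
IsBipartite G side = ∀ {u v} → Adj G u v → side v ≡ not (side u)

module _ {G : Graph} {side : V G → Bool} (bipartite : IsBipartite G side) where

  side-even : ∀ {n c} → IsCycle G n c → ∀ k → side (c (k * 2)) ≡ side (c 0)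
  side-even C zero = refl
  side-even {c = c} C (suc k) = begin
    side (c (2 + k * 2))         ≡⟨ bipartite (adjacent (suc (k * 2))) ⟩
    not (side (c (1 + k * 2)))   ≡⟨ cong not (bipartite (adjacent (k * 2))) ⟩
    not (not (side (c (k * 2)))) ≡⟨ not-involutive _ ⟩
    side (c (k * 2))             ≡⟨ side-even C k ⟩
    side (c 0)                   ∎
    where
    open IsCycle C
    open ≡-Reasoning

  even-length : ∀ {n c} → IsCycle G n c → ∃ λ k → n ≡ k * 2
  even-length {n} {c} C with parityView n
  ... | even k = k , refl
  ... | odd k  = ⊥-elim (not-¬ refl (begin
    side (c 0)               ≡⟨ cong side closed ⟨
    side (c (suc (k * 2)))   ≡⟨ bipartite (adjacent (k * 2)) ⟩
    not (side (c (k * 2)))   ≡⟨ cong not (side-even C k) ⟩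
    not (side (c 0))         ∎))
    where
    open IsCycle C
    open ≡-Reasoning

  halve : ∀ {s k c} → side (c 0) ≡ s → 4 < k * 2 → IsCycle G (k * 2) c →
    IsCycle (Halved G side s) k (λ i → c (i * 2))
  halve {s} {k} {c} c₀≡s 4<2k C = record
    { 3≤n      = 4<*2⇒3≤ k 4<2k
    ; vertex   = λ i → vertex (i * 2) , trans (side-even C i) c₀≡s
    ; adjacent = λ i → distinct-+ (i * 2) z<s 2<2k ,
                       c (suc (i * 2)) , vertex _ , adjacent _ , adjacent _
    ; periodic = λ i → trans (cong c (*-distribʳ-+ 2 k i)) (periodic (i * 2))
    ; distinct = λ {i} {j} i<j j<i+k →
        distinct (*-monoˡ-< 2 i<j) (subst (j * 2 <_) (*-distribʳ-+ 2 i k) (*-monoˡ-< 2 j<i+k))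
    }
    where
    open IsCycle C
    2<2k : 2 < k * 2
    2<2k = ≤-trans (s≤s (s≤s (s≤s z≤n))) (<⇒≤ 4<2k)

  halved-cycle : ∀ s {n} → 4 < n → HasCycle G n → ∃ λ k → n ≡ k * 2 × HasCycle (Halved G side s) k
  halved-cycle s 4<n cycle with toCycle cycle
  ... | c , C with even-length C
  ... | k , refl with side (c 0) Bool.≟ s
  ... | yes c₀≡s = k , refl , fromCycle (halve c₀≡s 4<n C)
  ... | no c₀≢s  = k , refl , fromCycle (halve c₁≡s 4<n (IsCycle.rotate C))
    where
    c₁≡s : side (c 1) ≡ s
    c₁≡s = trans (bipartite (IsCycle.adjacent C 0)) (sym (¬-not (c₀≢s ∘ sym)))

  module _ (symmetric : Symmetric (Adj G)) where

    common-neighbour⇒triangle : ∀ {s x u v w} → Vtx G x →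
      Vtx (Halved G side s) u × Adj G u x → Vtx (Halved G side s) v × Adj G v x →
      Vtx (Halved G side s) w × Adj G w x →
      u ≢ v → v ≢ w → w ≢ u → HasCycle (Halved G side s) 3
    common-neighbour⇒triangle {s} vx (vu , ux) (vv , vx′) (vw , wx) u≢v v≢w w≢u =
      triangle (Halved G side s) vu vv vw u≢v v≢w w≢u
        (u≢v , _ , vx , ux , symmetric vx′)
        (v≢w , _ , vx , vx′ , symmetric wx)
        (w≢u , _ , vx , wx , symmetric ux)

    module Lift {s g D} (C : IsCycle (Halved G side s) g D) where
      open IsCycle C

      path : ∀ r → ∃ λ w → Vtx G w × Adj G (D r) w × Adj G w (D (suc r))
      path r = proj₂ (adjacent r)

      -- The common neighbour is read off at i % g so that it is g-periodic in i.
      middle : ℕ → V G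
      middle i = proj₁ (path (i % g))

      middle-vertex : ∀ i → Vtx G (middle i)
      middle-vertex i = proj₁ (proj₂ (path (i % g)))

      to-middle : ∀ i → Adj G (D i) (middle i)
      to-middle i = subst (λ u → Adj G u (middle i)) (periodic-% 0 i) (proj₁ (proj₂ (proj₂ (path (i % g)))))

      from-middle : ∀ i → Adj G (middle i) (D (suc i))
      from-middle i = subst (Adj G (middle i)) (periodic-% 1 i) (proj₂ (proj₂ (proj₂ (path (i % g)))))

      middle-periodic : ∀ i → middle (g + i) ≡ middle i
      middle-periodic i = cong (proj₁ ∘ path) (trans (cong (_% g) (+-comm g i)) ([m+n]%n≡m%n i g))

      D≢middle : ∀ i j → D i ≢ middle j
      D≢middle i j Di≡mj = not-¬ refl (begin
        s                  ≡⟨ proj₂ (vertex i) ⟨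
        side (D i)         ≡⟨ cong side Di≡mj ⟩
        side (middle j)    ≡⟨ bipartite (to-middle j) ⟩
        not (side (D j))   ≡⟨ cong not (proj₂ (vertex j)) ⟩
        not s              ∎)
        where open ≡-Reasoning

      -- A repeated middle vertex is a common neighbour of D i, D (1 + i), D j and
      -- D (1 + j), three of which are distinct.
      middle-distinct : ¬ HasCycle (Halved G side s) 3 →
        ∀ {i j} → i < j → j < i + g → middle i ≢ middle j
      middle-distinct no-triangle {i} {j} i<j j<i+g mi≡mj with m≤n⇒m<n∨m≡n i<j
      ... | inj₁ 1+i<j = no-triangle (common-neighbour⇒triangle (middle-vertex i)
        (vertex i , to-middle i)
        (vertex (suc i) , symmetric (from-middle i))
        (vertex j , subst (Adj G (D j)) (sym mi≡mj) (to-middle j))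
        (proj₁ (adjacent i)) (distinct 1+i<j (m<n⇒m<1+n j<i+g)) (distinct i<j j<i+g ∘ sym))
      ... | inj₂ refl = no-triangle (common-neighbour⇒triangle (middle-vertex i)
        (vertex i , to-middle i)
        (vertex (suc i) , symmetric (from-middle i))
        (vertex (2 + i) , symmetric (subst (λ x → Adj G x (D (2 + i))) (sym mi≡mj) (from-middle (suc i))))
        (proj₁ (adjacent i)) (proj₁ (adjacent (suc i))) (distinct-+ i z<s 3≤n ∘ sym))

      lifted : ¬ HasCycle (Halved G side s) 3 → IsCycle G (g * 2) (interleave D middle)
      lifted no-triangle = record
        { 3≤n      = ≤-trans 3≤n (m≤m*n g 2)
        ; vertex   = vertex′
        ; adjacent = adjacent′
        ; periodic = periodic′
        ; distinct = distinct′
        }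
        where
        e = interleave D middle
        vertex′ : ∀ a → Vtx G (e a)
        vertex′ a with parityView a
        ... | even k = proj₁ (vertex k)
        ... | odd k  = middle-vertex k
        adjacent′ : ∀ a → Adj G (e a) (e (suc a))
        adjacent′ a with parityView a
        ... | even k = to-middle k
        ... | odd k  = from-middle k
        periodic′ : ∀ a → e (g * 2 + a) ≡ e a
        periodic′ a with parityView a
        ... | even k = begin
          e (g * 2 + k * 2) ≡⟨ cong e (*-distribʳ-+ 2 g k) ⟨
          e ((g + k) * 2)   ≡⟨ interleave-even D middle (g + k) ⟩
          D (g + k)         ≡⟨ periodic k ⟩
          D k               ∎
          where open ≡-Reasoning
        ... | odd k = begin
          e (g * 2 + suc (k * 2)) ≡⟨ cong e (+-suc (g * 2) (k * 2)) ⟩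
          e (suc (g * 2 + k * 2)) ≡⟨ cong (e ∘ suc) (*-distribʳ-+ 2 g k) ⟨
          e (suc ((g + k) * 2))   ≡⟨ interleave-odd D middle (g + k) ⟩
          middle (g + k)          ≡⟨ middle-periodic k ⟩
          middle k                ∎
          where open ≡-Reasoning
        distinct′ : ∀ {a b} → a < b → b < a + g * 2 → e a ≢ e b
        distinct′ {a} {b} a<b b<a+2g with parityView a | parityView b
        ... | even i | even j = distinct (*-cancelʳ-< 2 i j a<b) (*2-cancel-<-+ i g b<a+2g)
        ... | odd i  | odd j  =
          middle-distinct no-triangle (*-cancelʳ-< 2 i j (s<s⁻¹ a<b)) (*2-cancel-<-+ i g (s<s⁻¹ b<a+2g))
        ... | even i | odd j  = D≢middle i j
        ... | odd i  | even j = D≢middle j i ∘ sym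

    halved-girth : ∀ s {g′ g} → IsGirth' G g′ → IsGirth (Halved G side s) g → g ≡ 3 ⊎ g ≡ g′ / 2
    halved-girth s {g′} {g} ((4<g′ , cycleG) , minimalG) (cycleH , minimalH)
      with g ≟ 3 | halved-cycle s 4<g′ cycleG
    ... | yes g≡3 | _                  = inj₁ g≡3
    ... | no g≢3  | k , refl , cycleHk = inj₂ (begin
      g         ≡⟨ ≤-antisym (minimalH k cycleHk) k≤g ⟩
      k         ≡⟨ m*n/n≡m k 2 ⟨
      k * 2 / 2 ∎)
      where
      open ≡-Reasoning
      C = proj₂ (toCycle cycleH)
      3≤g = IsCycle.3≤n C
      no-triangle : ¬ HasCycle (Halved G side s) 3
      no-triangle triangle₃ = g≢3 (≤-antisym (minimalH 3 triangle₃) 3≤g)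
      k≤g : k ≤ g
      k≤g = *-cancelʳ-≤ k g 2
        (minimalG (g * 2) (*-monoˡ-< 2 3≤g) (fromCycle (Lift.lifted C no-triangle)))

prime-divisor : ∀ {n} → 1 < n → ∃ λ p → Prime p × p ∣ n
prime-divisor {suc n} 1<n with factorise (suc n)
... | record { factors = [] ; isFactorisation = n≡1 } = ⊥-elim (<⇒≢ 1<n (sym n≡1))
... | record { factors = p ∷ ps ; isFactorisation = n≡p*ps ; factorsPrime = prime[p] ∷ _ } =
  p , prime[p] , subst (p ∣_) (sym n≡p*ps) (m∣m*n _)

prime∣⇒≢1 : ∀ {p x} → Prime p → p ∣ x → x ≢ 1
prime∣⇒≢1 prime[p] p∣1 refl = ¬prime[1] (subst Prime (∣1⇒≡1 p∣1) prime[p])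

distinct-primes⇒coprime : ∀ {p q} → Prime p → Prime q → p ≢ q → Coprime p q
distinct-primes⇒coprime prime[p] prime[q] p≢q (d∣p , d∣q) with prime⇒irreducible prime[p] d∣p
... | inj₁ d≡1 = d≡1
... | inj₂ refl with prime⇒irreducible prime[q] d∣q
... | inj₁ refl = ⊥-elim (¬prime[1] prime[p])
... | inj₂ p≡q  = ⊥-elim (p≢q p≡q)

distinct-primes-∣⇒*-∣ : ∀ {p q x} → Prime p → Prime q → p ≢ q → p ∣ x → q ∣ x → p * q ∣ x
distinct-primes-∣⇒*-∣ {p} {q} {x} prime[p] prime[q] p≢q (divides a x≡ap) q∣x
  with coprime-divisor (distinct-primes⇒coprime prime[q] prime[p] (p≢q ∘ sym))
                       (subst (q ∣_) (trans x≡ap (*-comm a p)) q∣x)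
... | divides b a≡bq = divides b (begin
  x           ≡⟨ x≡ap ⟩
  a * p       ≡⟨ cong (_* p) a≡bq ⟩
  b * q * p   ≡⟨ *-assoc b q p ⟩
  b * (q * p) ≡⟨ cong (b *_) (*-comm q p) ⟩
  b * (p * q) ∎)
  where open ≡-Reasoning

common-prime⇒1<gcd : ∀ {p x y} → Prime p → p ∣ x → p ∣ y → 0 < x → 1 < gcd x y
common-prime⇒1<gcd {p} {x} {y} prime[p] p∣x p∣y 0<x =
  <-≤-trans (nonTrivial⇒n>1 p {{prime⇒nonTrivial prime[p]}})
            (∣⇒≤ {{≢-nonZero gcd≢0}} (gcd-greatest p∣x p∣y))
  where
  gcd≢0 : gcd x y ≢ 0
  gcd≢0 = <⇒≢ 0<x ∘ sym ∘ gcd[m,n]≡0⇒m≡0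

-- The bipartite graph B(X)

primeSide : ℕ ⊎ ℕ → Bool
primeSide = [ const true , const false ]′

B-bipartite : ∀ X → IsBipartite (B X) primeSide
B-bipartite X {inj₁ _} {inj₂ _} _ = refl
B-bipartite X {inj₂ _} {inj₁ _} _ = refl

B-symmetric : ∀ X → Symmetric (Adj (B X))
B-symmetric X {inj₁ _} {inj₂ _} p∣x = p∣x
B-symmetric X {inj₂ _} {inj₁ _} p∣x = p∣x

Δ↪halved : ∀ X → Embedding (Δ X) (Halved (B X) primeSide true)
Δ↪halved X = record
  { map       = inj₁
  ; vertex    = λ ρ[p] → ρ[p] , refl
  ; adjacent  = adjacent
  ; injective = λ _ _ → inj₁-injective
  }
  where
  adjacent : ∀ {p q} → ρ X p → ρ X q → Adj (Δ X) p q →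
    Adj (Halved (B X) primeSide true) (inj₁ p) (inj₁ q)
  adjacent {p} {q} (prime[p] , _) _ (p≢q , x , x∈X , pq∣x) =
    p≢q ∘ inj₁-injective , inj₂ x , (x∈X , prime∣⇒≢1 prime[p] p∣x) , p∣x , ∣-trans (n∣m*n p) pq∣x
    where
    p∣x : p ∣ x
    p∣x = ∣-trans (m∣m*n q) pq∣x

halved↪Δ : ∀ X → Embedding (Halved (B X) primeSide true) (Δ X)
halved↪Δ X = record
  { map       = reduce
  ; vertex    = vertex
  ; adjacent  = adjacent
  ; injective = injective
  }
  where
  H = Halved (B X) primeSide true
  vertex : ∀ {u} → Vtx H u → ρ X (reduce u)
  vertex {inj₁ _} (ρ[p] , _) = ρ[p]
  adjacent : ∀ {u v} → Vtx H u → Vtx H v → Adj H u v → Adj (Δ X) (reduce u) (reduce v)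
  adjacent {inj₁ p} {inj₁ q} ((prime[p] , _) , _) ((prime[q] , _) , _)
           (u≢v , inj₂ x , (x∈X , _) , p∣x , q∣x) =
    p≢q , x , x∈X , distinct-primes-∣⇒*-∣ prime[p] prime[q] p≢q p∣x q∣x
    where
    p≢q : p ≢ q
    p≢q = u≢v ∘ cong inj₁
  injective : ∀ {u v} → Vtx H u → Vtx H v → reduce u ≡ reduce v → u ≡ v
  injective {inj₁ _} {inj₁ _} _ _ = cong inj₁

Γ↪halved : ∀ X → Embedding (Γ X) (Halved (B X) primeSide false)
Γ↪halved X = record
  { map       = inj₂
  ; vertex    = λ x∈X* → x∈X* , refl
  ; adjacent  = adjacent
  ; injective = λ _ _ → inj₂-injective
  }
  where
  adjacent : ∀ {x y} → Star X x → Star X y → Adj (Γ X) x y →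
    Adj (Halved (B X) primeSide false) (inj₂ x) (inj₂ y)
  adjacent {x} {y} (x∈X , _) _ (x≢y , 1<gcd) with prime-divisor 1<gcd
  ... | p , prime[p] , p∣gcd =
    x≢y ∘ inj₂-injective , inj₁ p , (prime[p] , x , x∈X , p∣x) , p∣x , ∣-trans p∣gcd (gcd[m,n]∣n x y)
    where
    p∣x : p ∣ x
    p∣x = ∣-trans p∣gcd (gcd[m,n]∣m x y)

halved↪Γ : ∀ X → (∀ x → X x → 0 < x) → Embedding (Halved (B X) primeSide false) (Γ X)
halved↪Γ X positive = record
  { map       = reduce
  ; vertex    = vertex
  ; adjacent  = adjacent
  ; injective = injective
  }
  where
  H = Halved (B X) primeSide false
  vertex : ∀ {u} → Vtx H u → Star X (reduce u)
  vertex {inj₂ _} (x∈X* , _) = x∈X*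
  adjacent : ∀ {u v} → Vtx H u → Vtx H v → Adj H u v → Adj (Γ X) (reduce u) (reduce v)
  adjacent {inj₂ x} {inj₂ y} ((x∈X , _) , _) _ (u≢v , inj₁ p , (prime[p] , _) , p∣x , p∣y) =
    u≢v ∘ cong inj₂ , common-prime⇒1<gcd prime[p] p∣x p∣y (positive x x∈X)
  injective : ∀ {u v} → Vtx H u → Vtx H v → reduce u ≡ reduce v → u ≡ v
  injective {inj₂ _} {inj₂ _} _ _ = cong inj₂

lemma3p2 : (X : Subset) →
    (∀ x → X x → 0 < x) →
    ∃ X →
    ¬ (∀ x → X x → x ≡ 1) →
    (∃ λ n → 4 < n × HasCycle (B X) n) →
    (∃ (HasCycle (Δ X))) × (∃ (HasCycle (Γ X))) ×
    (∀ g' g → IsGirth' (B X) g' → IsGirth (Δ X) g → g ≡ 3 ⊎ g ≡ g' / 2) ×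
    (∀ g' g → IsGirth' (B X) g' → IsGirth (Γ X) g → g ≡ 3 ⊎ g ≡ g' / 2)
-- X ≠ ∅ and X ≠ {1} are implied by the cycle in B(X).
lemma3p2 X positive _ _ (n , 4<n , cycle) =
  map₂ (Embedding.hasCycle (halved↪Δ X) ∘ proj₂) (halved-cycle (B-bipartite X) true 4<n cycle) ,
  map₂ (Embedding.hasCycle (halved↪Γ X positive) ∘ proj₂) (halved-cycle (B-bipartite X) false 4<n cycle) ,
  (λ g′ g girth′ girth → halved-girth (B-bipartite X) (B-symmetric X) true girth′
    (isGirth-transfer (Δ↪halved X) (halved↪Δ X) girth)) ,
  (λ g′ g girth′ girth → halved-girth (B-bipartite X) (B-symmetric X) false girth′
    (isGirth-transfer (Γ↪halved X) (halved↪Γ X positive) girth))
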